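{- Let $(G,\sigma)$ be a signed graph. If $(G,\sigma)$ is switching equivalent to $(G,-)$ (all edges negative), then $EDC(G,\sigma)$ is a signed bipartite graph whose negative girth is $g_{ - }(G,\sigma)+1$. Conversely, if $(G,\sigma)$ is a signed bipartite graph, then there is a switching of $EDC(G,\sigma)$ after which all edges are negative, and moreover the negative girth of $EDC(G,\sigma)$, which is equal to the odd girth of its underlying graph, is $g_{ - }(G,\sigma)+1$.
   Context: A signed graph $(G,\sigma)$ is a graph $G$ with $\sigma:E(G)\to\{+,-\}$ (at most one edge of each sign between two vertices). Switching at a vertex set $X$ multiplies by $-1$ the signs of the edges with exactly one end in $X$; two signatures are switching equivalent if one is obtained from the other by a switching. The sign of a cycle or closed walk is the product of the signs of its edges (with multiplicity). The negative (unbalanced) girth $g_-(G,\sigma)$ is the length of a shortest negative cycle, $\infty$ if there is none. A signed bipartite graph is a signed graph whose underlying graph is bipartite. The extended double cover $EDC(G,\sigma)$ has two vertices $x_0,x_1$ for each vertex $x$ of $G$ joined by a negative edge; each positive edge $xy$ of $(G,\sigma)$ yields positive edges $x_0y_0$ and $x_1y_1$; each negative edge $xy$ of $(G,\sigma)$ yields positive edges $x_0y_1$ and $x_1y_0$; there are no other edges. -}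

module Defs where

open import Data.Nat using (ℕ; zero; suc; _≤_; _%_)
import Data.Nat as ℕ
open import Data.Fin using (Fin; zero; suc; toℕ; lower₁)
import Data.Fin as F
open import Data.Bool using (Bool; true; false; _xor_; if_then_else_; not; _∧_)
open import Data.Bool.Properties using (xor-same)
open import Data.Product using (Σ; _×_; _,_; ∃)
open import Data.Empty using (⊥-elim)
open import Data.Maybe using (Maybe; just; nothing)
open import Relation.Nullary using (¬_; yes; no)
open import Relation.Nullary.Decidable using (⌊_⌋)
open import Relation.Binary.PropositionalEquality using (_≡_; _≢_; refl; cong)
open import Function.Definitions using (Injective)

data Sign : Set where
  pos neg : Sign

_·_ : Sign → Sign → Sign
pos · s = s
neg · pos = neg
neg · neg = pos

switchSign : Bool → Bool → Sign
switchSign a b = if a xor b then neg else pos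

-- At most one edge of each sign between two vertices (both signs may be
-- present simultaneously); no loops.

record SignedGraph (V : Set) : Set where
  field
    edge   : Sign → V → V → Bool
    sym    : ∀ s x y → edge s x y ≡ edge s y x
    irrefl : ∀ s x → edge s x x ≡ false
open SignedGraph public

private
  xor-comm : ∀ a b → a xor b ≡ b xor a
  xor-comm false false = refl
  xor-comm false true = refl
  xor-comm true false = refl
  xor-comm true true = refl

switch : ∀ {V} → (V → Bool) → SignedGraph V → SignedGraph V
switch X σ = record
  { edge   = λ s x y → edge σ (s · switchSign (X x) (X y)) x y
  ; sym    = λ s x y → symP s x y
  ; irrefl = λ s x → irrP s x
  }
  where
  symP : ∀ s x y → edge σ (s · switchSign (X x) (X y)) x y
                 ≡ edge σ (s · switchSign (X y) (X x)) y x
  symP s x y rewrite xor-comm (X x) (X y) = sym σ _ x y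
  irrP : ∀ s x → edge σ (s · switchSign (X x) (X x)) x x ≡ false
  irrP s x = irrefl σ _ x

AllNegative : ∀ {V} → SignedGraph V → Set
AllNegative {V} σ = ∀ (x y : V) → edge σ pos x y ≡ false

SwitchingEquivalentToAllNegative : ∀ {V} → SignedGraph V → Set
SwitchingEquivalentToAllNegative {V} σ = Σ (V → Bool) λ X → AllNegative (switch X σ)

IsBipartite : ∀ {V} → SignedGraph V → Set
IsBipartite {V} σ =
  Σ (V → Bool) λ col → ∀ s x y → edge σ s x y ≡ true → col x ≢ col y

-- Extended double cover, for vertex set Fin n (vertex (x , b) is x_b)

private
  eqB : Bool → Bool → Bool
  eqB a b = not (a xor b)

  eqB-sym : ∀ a b → eqB a b ≡ eqB b a
  eqB-sym a b = cong not (xor-comm a b)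

  eqF : ∀ {n} → Fin n → Fin n → Bool
  eqF x y = ⌊ x F.≟ y ⌋

  eqF-sym : ∀ {n} (x y : Fin n) → eqF x y ≡ eqF y x
  eqF-sym x y with x F.≟ y | y F.≟ x
  ... | yes _ | yes _ = refl
  ... | no _  | no _  = refl
  ... | yes refl | no ne = ⊥-elim (ne refl)
  ... | no ne | yes refl = ⊥-elim (ne refl)

  xor-self : ∀ a → a xor a ≡ false
  xor-self false = refl
  xor-self true = refl

  edc-edge : ∀ {n} → SignedGraph (Fin n) → Sign → Fin n × Bool → Fin n × Bool → Bool
  -- negative edges: x_0 x_1 for each vertex x
  edc-edge σ neg (x , a) (y , b) = eqF x y ∧ (a xor b)
  -- positive edges: x_i y_i from positive xy, x_i y_(1-i) from negative xy
  edc-edge σ pos (x , a) (y , b) = if eqB a b then edge σ pos x y else edge σ neg x y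

  edc-sym : ∀ {n} (σ : SignedGraph (Fin n)) s u v → edc-edge σ s u v ≡ edc-edge σ s v u
  edc-sym σ neg (x , a) (y , b) rewrite eqF-sym x y | xor-comm a b = refl
  edc-sym σ pos (x , a) (y , b) rewrite eqB-sym a b | sym σ pos x y | sym σ neg x y = refl

  edc-irr : ∀ {n} (σ : SignedGraph (Fin n)) s u → edc-edge σ s u u ≡ false
  edc-irr σ neg (x , a) rewrite xor-self a with eqF x x
  ... | true = refl
  ... | false = refl
  edc-irr σ pos (x , a) rewrite xor-self a = irrefl σ pos x

EDC : ∀ {n} → SignedGraph (Fin n) → SignedGraph (Fin n × Bool)
EDC σ = record { edge = edc-edge σ ; sym = edc-sym σ ; irrefl = edc-irr σ }

-- A cycle of length k is a cyclic sequence of k ≥ 2 distinct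
-- vertices vs 0, …, vs (k-1) together with, for each i, a sign ss i such
-- that vs i and vs (i+1 mod k) are joined by an edge of sign ss i; the k
-- edges used must be pairwise distinct (this only matters for k = 2,
-- where a 2-cycle consists of a positive and a negative parallel edge).

next : ∀ {k} → Fin k → Fin k
next {suc m} i with m ℕ.≟ toℕ i
... | yes _ = zero
... | no ne = suc (lower₁ i ne)

signProd : ∀ {k} → (Fin k → Sign) → Sign
signProd {zero} f = pos
signProd {suc k} f = f zero · signProd (λ i → f (suc i))

record Cycle {V : Set} (σ : SignedGraph V) (k : ℕ) : Set where
  field
    len≥2    : 2 ≤ k
    vs       : Fin k → V
    ss       : Fin k → Sign
    distinct : Injective _≡_ _≡_ vs
    adjacent : ∀ i → edge σ (ss i) (vs i) (vs (next i)) ≡ true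
    edgesDistinct : ∀ i j → i ≢ j → vs i ≡ vs (next j) → vs (next i) ≡ vs j
                    → ss i ≢ ss j
open Cycle public

cycleSign : ∀ {V} {σ : SignedGraph V} {k} → Cycle σ k → Sign
cycleSign c = signProd (ss c)

IsNegativeCycle : ∀ {V} {σ : SignedGraph V} {k} → Cycle σ k → Set
IsNegativeCycle c = cycleSign c ≡ neg

-- g_-(σ) = m, with nothing standing for ∞
IsNegativeGirth : ∀ {V} → SignedGraph V → Maybe ℕ → Set
IsNegativeGirth σ nothing =
  ∀ k (c : Cycle σ k) → ¬ IsNegativeCycle c
IsNegativeGirth σ (just g) =
  Σ (Cycle σ g) IsNegativeCycle
  × (∀ k (c : Cycle σ k) → IsNegativeCycle c → g ≤ k)

-- odd girth of the underlying graph (cycles of the underlying graph are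
-- the cycles above, ignoring signs); nothing stands for ∞
IsOddGirth : ∀ {V} → SignedGraph V → Maybe ℕ → Set
IsOddGirth σ nothing =
  ∀ k → Cycle σ k → ¬ (k % 2 ≡ 1)
IsOddGirth σ (just g) =
  (Cycle σ g × g % 2 ≡ 1)
  × (∀ k → Cycle σ k → k % 2 ≡ 1 → g ≤ k)

_+1 : Maybe ℕ → Maybe ℕ
just g +1 = just (suc g)
nothing +1 = nothing

-- A shortest negative closed walk is a negative cycle, so the negative girth is the least
-- length of a negative closed walk.  A walk of σ of sign s lifts to a positive walk of EDC σ
-- that changes layer iff s is negative; a negative closed walk of length k therefore lifts and
-- closes up with one vertical edge to a negative closed walk of length k + 1.  Conversely, a
-- negative closed walk of EDC σ uses an odd number of vertical edges, and deleting them leaves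
-- a strictly shorter negative closed walk of σ.  If σ switches to (G,-) at X, colouring x_a
-- by X x xor a is a proper 2-colouring of EDC σ; if σ is bipartite with colouring c, switching
-- EDC σ at the vertices x_a with c x = true makes all its edges negative, and then the sign of
-- every cycle is the parity of its length, so negative and odd girth coincide.

module Submission where

open import Defs hiding (sym)
open import Relation.Binary.PropositionalEquality
  using (_≡_; _≢_; refl; sym; trans; cong; cong₂; subst; isEquivalence; module ≡-Reasoning)
open import Algebra.Bundles using (CommutativeSemigroup)
open import Algebra.Definitions {A = Sign} _≡_ using (Associative; Commutative; RightIdentity)
open import Algebra.Structures {A = Sign} _≡_ using (IsCommutativeSemigroup)
import Algebra.Properties.CommutativeSemigroup as CommutativeSemigroupProperties
open import Data.Bool using (Bool; true; false; not; _xor_)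
open import Data.Bool.Properties using (¬-not)
import Data.Bool.Properties as Bool
open import Data.Empty using (⊥-elim)
open import Data.Fin as Fin using (Fin; zero; suc; toℕ; inject₁; fromℕ)
open import Data.Fin.Properties using (any?; injective⇒≤; toℕ-inject₁; toℕ<n; toℕ-fromℕ; toℕ-lower₁; lower₁-inject₁′)
open import Data.Fin.Relation.Unary.Top using (view; ‵fromℕ; ‵inject₁)
open import Data.Maybe using (Maybe; just; nothing)
open import Data.Nat using (ℕ; zero; suc; _+_; _≤_; _<_; _%_; z≤n; s≤s)
import Data.Nat as ℕ
open import Data.Nat.Induction using (<-wellFounded)
import Data.Nat.Properties as ℕ
open import Data.Product using (Σ; ∃; _×_; _,_; proj₁; proj₂)
open import Data.Product.Properties using (≡-dec)
open import Data.Sum using (_⊎_; inj₁; inj₂; [_,_])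
open import Function using (_∘_; case_of_)
open import Function.Definitions using (Injective)
open import Induction.WellFounded using (Acc; acc)
open import Relation.Binary.Definitions using (DecidableEquality)
open import Relation.Nullary using (¬_; Dec; yes; no)
open import Relation.Nullary.Decidable using (map′; _×-dec_; _⊎-dec_)

private
  variable
    a b : Bool
    k m n : ℕ
    P Q : ℕ → Set

·-assoc : Associative _·_
·-assoc pos b c = refl
·-assoc neg pos c = refl
·-assoc neg neg pos = refl
·-assoc neg neg neg = refl

·-comm : Commutative _·_
·-comm pos pos = refl
·-comm pos neg = refl
·-comm neg pos = refl
·-comm neg neg = refl

·-identityʳ : RightIdentity pos _·_
·-identityʳ pos = refl
·-identityʳ neg = refl

·-isCommutativeSemigroup : IsCommutativeSemigroup _·_
·-isCommutativeSemigroup = record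
  { isSemigroup = record
    { isMagma = record { isEquivalence = isEquivalence ; ∙-cong = cong₂ _·_ }
    ; assoc = ·-assoc }
  ; comm = ·-comm }

·-commutativeSemigroup : CommutativeSemigroup _ _
·-commutativeSemigroup = record { isCommutativeSemigroup = ·-isCommutativeSemigroup }

open CommutativeSemigroupProperties ·-commutativeSemigroup
  using () renaming (interchange to ·-interchange; x∙yz≈y∙xz to a·[b·c]≡b·[a·c])
open CommutativeSemigroupProperties ℕ.+-commutativeSemigroup
  using () renaming (x∙yz≈y∙xz to m+[n+o]≡n+[m+o])

neg-involutive : ∀ s → neg · (neg · s) ≡ s
neg-involutive pos = refl
neg-involutive neg = refl

·≡pos⇒≡ : ∀ {s t} → s · t ≡ pos → s ≡ t
·≡pos⇒≡ {pos} {pos} _ = refl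
·≡pos⇒≡ {neg} {neg} _ = refl

·≡neg⇒≢ : ∀ {s t} → s · t ≡ neg → s ≢ t
·≡neg⇒≢ {pos} {pos} () _
·≡neg⇒≢ {neg} {neg} () _

·≡neg⇒neg⊎neg : ∀ {s t} → s · t ≡ neg → s ≡ neg ⊎ t ≡ neg
·≡neg⇒neg⊎neg {pos} t≡neg = inj₂ t≡neg
·≡neg⇒neg⊎neg {neg} _ = inj₁ refl

≢⇒≡neg· : ∀ {s t} → s ≢ t → s ≡ neg · t
≢⇒≡neg· {pos} {pos} s≢t = ⊥-elim (s≢t refl)
≢⇒≡neg· {pos} {neg} _ = refl
≢⇒≡neg· {neg} {pos} _ = refl
≢⇒≡neg· {neg} {neg} s≢t = ⊥-elim (s≢t refl)

switchSign-refl : ∀ a → switchSign a a ≡ pos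
switchSign-refl false = refl
switchSign-refl true = refl

switchSign-trans : ∀ a b c → switchSign a b · switchSign b c ≡ switchSign a c
switchSign-trans false false c = refl
switchSign-trans false true false = refl
switchSign-trans false true true = refl
switchSign-trans true false false = refl
switchSign-trans true false true = refl
switchSign-trans true true c = refl

switchSign-≢ : a ≢ b → switchSign a b ≡ neg
switchSign-≢ {false} {false} a≢b = ⊥-elim (a≢b refl)
switchSign-≢ {false} {true} _ = refl
switchSign-≢ {true} {false} _ = refl
switchSign-≢ {true} {true} a≢b = ⊥-elim (a≢b refl)

switchSign-xor : ∀ p q a b → switchSign (p xor a) (q xor b) ≡ switchSign p q · switchSign a b
switchSign-xor false false a b = refl
switchSign-xor false true false false = refl
switchSign-xor false true false true = refl
switchSign-xor false true true false = refl
switchSign-xor false true true true = refl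
switchSign-xor true false false false = refl
switchSign-xor true false false true = refl
switchSign-xor true false true false = refl
switchSign-xor true false true true = refl
switchSign-xor true true false false = refl
switchSign-xor true true false true = refl
switchSign-xor true true true false = refl
switchSign-xor true true true true = refl

xor≡⇒switchSign≡ : ∀ p q a b → p xor a ≡ q xor b → switchSign p q ≡ switchSign a b
xor≡⇒switchSign≡ p q a b same =
  ·≡pos⇒≡ (trans (sym (switchSign-xor p q a b))
                 (trans (cong (λ c → switchSign c (q xor b)) same) (switchSign-refl (q xor b))))

parity : ℕ → Sign
parity zero = pos
parity (suc k) = neg · parity k

parity≡neg⇒odd : ∀ k → parity k ≡ neg → k % 2 ≡ 1
parity≡neg⇒odd (suc zero) _ = refl
parity≡neg⇒odd (suc (suc k)) p = parity≡neg⇒odd k (trans (sym (neg-involutive (parity k))) p)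

odd⇒parity≡neg : ∀ k → k % 2 ≡ 1 → parity k ≡ neg
odd⇒parity≡neg (suc zero) _ = refl
odd⇒parity≡neg (suc (suc k)) odd = trans (neg-involutive (parity k)) (odd⇒parity≡neg k odd)

Least : (ℕ → Set) → Maybe ℕ → Set
Least P nothing = ∀ k → ¬ P k
Least P (just k) = P k × (∀ j → P j → k ≤ j)

least-search : (∀ k → Dec (P k)) → ∀ N →
               (∃ λ k → P k × ∀ j → j < k → ¬ P j) ⊎ (∀ j → j < N → ¬ P j)
least-search P? zero = inj₂ λ _ ()
least-search P? (suc N) with least-search P? N
... | inj₁ found = inj₁ found
... | inj₂ none with P? N
...   | yes p = inj₁ (N , p , none)
...   | no ¬p = inj₂ λ j j<1+N → [ none j , (λ { refl → ¬p }) ] (ℕ.m<1+n⇒m<n∨m≡n j<1+N)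

least? : (∀ k → Dec (P k)) → ∀ N → (∀ k → P k → ∃ λ j → j ≤ N × P j) → ∃ (Least P)
least? P? N bounded with least-search P? (suc N)
... | inj₁ (k , p , below) = just k , p , λ j q → ℕ.≮⇒≥ λ j<k → below j j<k q
... | inj₂ none = nothing , λ k q → let (j , j≤N , p) = bounded k q in none j (s≤s j≤N) p

least-cong : (∀ k → P k → ∃ λ j → j ≤ k × Q j) → (∀ k → Q k → ∃ λ j → j ≤ k × P j) →
             ∀ {m} → Least P m → Least Q m
least-cong P⇒Q Q⇒P {nothing} none k q = let (j , _ , p) = Q⇒P k q in none j p
least-cong {Q = Q} P⇒Q Q⇒P {just k} (p , least) with P⇒Q k p
... | j , j≤k , q = subst Q (ℕ.≤-antisym j≤k (lower-bound j q)) q , lower-bound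
  where
  lower-bound : ∀ i → Q i → k ≤ i
  lower-bound i qi = let (j , j≤i , pj) = Q⇒P i qi in ℕ.≤-trans (least j pj) j≤i

least-suc : (∀ k → P k → Q (suc k)) → (∀ k → Q k → ∃ λ j → j < k × P j) →
            ∀ {m} → Least P m → Least Q (m +1)
least-suc P⇒Q Q⇒P {nothing} none k q = let (j , _ , p) = Q⇒P k q in none j p
least-suc P⇒Q Q⇒P {just k} (p , least) =
  P⇒Q k p , λ i q → let (j , j<i , pj) = Q⇒P i q in ℕ.≤-<-trans (least j pj) j<i

next-inject₁ : (i : Fin m) → next {suc m} (inject₁ i) ≡ suc i
next-inject₁ {m} i with m ℕ.≟ toℕ (inject₁ i)
... | yes m≡i = ⊥-elim (ℕ.<-irrefl (sym (trans m≡i (toℕ-inject₁ i))) (toℕ<n i))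
... | no m≢i = cong suc (lower₁-inject₁′ i m≢i)

next-fromℕ : ∀ m → next (fromℕ m) ≡ zero
next-fromℕ m with m ℕ.≟ toℕ (fromℕ m)
... | yes _ = refl
... | no m≢m = ⊥-elim (m≢m (sym (toℕ-fromℕ m)))

toℕ-next : (i : Fin (suc m)) → (toℕ i ≡ m × toℕ (next i) ≡ 0) ⊎ toℕ (next i) ≡ suc (toℕ i)
toℕ-next {m} i with m ℕ.≟ toℕ i
... | yes m≡i = inj₁ (sym m≡i , refl)
... | no m≢i = inj₂ (cong suc (toℕ-lower₁ i m≢i))

next²≢id : (i : Fin (3 + m)) → next (next i) ≢ i
next²≢id i i″≡i = no-2-cycle (toℕ-next i) (toℕ-next (next i)) (cong toℕ i″≡i)
  where
  no-2-cycle : ∀ {m i i′ i″} → (i ≡ suc (suc m) × i′ ≡ 0) ⊎ i′ ≡ suc i →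
               (i′ ≡ suc (suc m) × i″ ≡ 0) ⊎ i″ ≡ suc i′ → i″ ≢ i
  no-2-cycle (inj₁ (refl , refl)) (inj₂ refl) ()
  no-2-cycle (inj₂ refl) (inj₁ (refl , refl)) ()
  no-2-cycle (inj₂ refl) (inj₂ refl) ()

signProd-last : ∀ {m} (s : Fin (suc m) → Sign) → signProd s ≡ signProd (s ∘ inject₁) · s (fromℕ m)
signProd-last {zero} s = ·-identityʳ (s zero)
signProd-last {suc m} s =
  trans (cong (s zero ·_) (signProd-last (s ∘ suc))) (sym (·-assoc (s zero) _ _))

module _ {V : Set} where

  private
    variable
      σ τ : SignedGraph V
      x y z u : V

  Edge : SignedGraph V → Sign → V → V → Set
  Edge σ s x y = edge σ s x y ≡ true

  infixr 5 _++_

  data Walk (σ : SignedGraph V) : V → V → Set where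
    []   : ∀ {x} → Walk σ x x
    step : ∀ {x y z} s → Edge σ s x y → Walk σ y z → Walk σ x z

  length : Walk σ x y → ℕ
  length [] = 0
  length (step _ _ W) = suc (length W)

  sign : Walk σ x y → Sign
  sign [] = pos
  sign (step s _ W) = s · sign W

  negatives : Walk σ x y → ℕ
  negatives [] = 0
  negatives (step pos _ W) = negatives W
  negatives (step neg _ W) = suc (negatives W)

  _++_ : Walk σ x y → Walk σ y z → Walk σ x z
  [] ++ W = W
  step s e A ++ W = step s e (A ++ W)

  length-++ : (A : Walk σ x y) (B : Walk σ y z) → length (A ++ B) ≡ length A + length B
  length-++ [] B = refl
  length-++ (step s e A) B = cong suc (length-++ A B)

  sign-++ : (A : Walk σ x y) (B : Walk σ y z) → sign (A ++ B) ≡ sign A · sign B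
  sign-++ [] B = refl
  sign-++ (step s e A) B = trans (cong (s ·_) (sign-++ A B)) (sym (·-assoc s (sign A) (sign B)))

  sign≡parity-negatives : (W : Walk σ x y) → sign W ≡ parity (negatives W)
  sign≡parity-negatives [] = refl
  sign≡parity-negatives (step pos _ W) = sign≡parity-negatives W
  sign≡parity-negatives (step neg _ W) = cong (neg ·_) (sign≡parity-negatives W)

  HasWalk : SignedGraph V → V → V → ℕ → Sign → Set
  HasWalk σ x y k s = Σ (Walk σ x y) λ W → length W ≡ k × sign W ≡ s

  NegativeClosedWalk : SignedGraph V → ℕ → Set
  NegativeClosedWalk σ k = Σ V λ x → HasWalk σ x x k neg

  NegativeCycle : SignedGraph V → ℕ → Set
  NegativeCycle σ k = Σ (Cycle σ k) IsNegativeCycle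

  OddCycle : SignedGraph V → ℕ → Set
  OddCycle σ k = Cycle σ k × k % 2 ≡ 1

  source : (W : Walk σ x y) → Fin (length W) → V
  source (step {x = x} _ _ _) zero = x
  source (step _ _ W) (suc i) = source W i

  target : (W : Walk σ x y) → Fin (length W) → V
  target (step {y = y} _ _ _) zero = y
  target (step _ _ W) (suc i) = target W i

  signAt : (W : Walk σ x y) → Fin (length W) → Sign
  signAt (step s _ _) zero = s
  signAt (step _ _ W) (suc i) = signAt W i

  edgeAt : (W : Walk σ x y) (i : Fin (length W)) → Edge σ (signAt W i) (source W i) (target W i)
  edgeAt (step _ e _) zero = e
  edgeAt (step _ _ W) (suc i) = edgeAt W i

  signProd-signAt : (W : Walk σ x y) → signProd (signAt W) ≡ sign W
  signProd-signAt [] = refl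
  signProd-signAt (step s _ W) = cong (s ·_) (signProd-signAt W)

  target-inject₁ : ∀ {s} (e : Edge σ s x y) (W : Walk σ y z) (i : Fin (length W)) →
                   target (step s e W) (inject₁ i) ≡ source W i
  target-inject₁ e (step _ _ W) zero = refl
  target-inject₁ e (step s′ e′ W) (suc i) = target-inject₁ e′ W i

  target-fromℕ : ∀ {s} (e : Edge σ s x y) (W : Walk σ y z) → target (step s e W) (fromℕ (length W)) ≡ z
  target-fromℕ e [] = refl
  target-fromℕ e (step _ e′ W) = target-fromℕ e′ W

  target≡source∘next : (W : Walk σ x x) (i : Fin (length W)) → target W i ≡ source W (next i)
  target≡source∘next (step s e W) i with view i
  ... | ‵fromℕ = trans (target-fromℕ e W) (cong (source (step s e W)) (sym (next-fromℕ (length W))))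
  ... | ‵inject₁ j = trans (target-inject₁ e W j) (cong (source (step s e W)) (sym (next-inject₁ j)))

  negativeClosedWalk-length≥2 : (W : Walk σ x x) → sign W ≡ neg → 2 ≤ length W
  negativeClosedWalk-length≥2 {σ = σ} (step s e []) _ = case trans (sym e) (irrefl σ s _) of λ ()
  negativeClosedWalk-length≥2 (step _ _ (step _ _ _)) _ = s≤s (s≤s z≤n)

  closedWalk-edgesDistinct :
    (W : Walk σ x x) → sign W ≡ neg → Injective _≡_ _≡_ (source W) →
    ∀ i j → i ≢ j → source W i ≡ source W (next j) → source W (next i) ≡ source W j →
    signAt W i ≢ signAt W j
  closedWalk-edgesDistinct (step _ _ []) _ _ zero zero i≢j _ _ = ⊥-elim (i≢j refl)
  closedWalk-edgesDistinct (step _ _ (step _ _ [])) _ _ zero zero i≢j _ _ = ⊥-elim (i≢j refl)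
  closedWalk-edgesDistinct (step _ _ (step _ _ [])) _ _ (suc zero) (suc zero) i≢j _ _ = ⊥-elim (i≢j refl)
  closedWalk-edgesDistinct (step s₀ _ (step s₁ _ [])) W⁻ _ zero (suc zero) _ _ _ =
    ·≡neg⇒≢ (trans (cong (s₀ ·_) (sym (·-identityʳ s₁))) W⁻)
  closedWalk-edgesDistinct (step s₀ _ (step s₁ _ [])) W⁻ _ (suc zero) zero _ _ _ =
    ·≡neg⇒≢ (trans (cong (s₀ ·_) (sym (·-identityʳ s₁))) W⁻) ∘ sym
  closedWalk-edgesDistinct (step _ _ (step _ _ (step _ _ _))) _ inj i j _ i≡j⁺ i⁺≡j _ =
    next²≢id j (trans (cong next (sym (inj {i} {next j} i≡j⁺))) (inj {next i} {j} i⁺≡j))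

  simpleNegativeCycle : (W : Walk σ x x) → sign W ≡ neg → Injective _≡_ _≡_ (source W) →
                        NegativeCycle σ (length W)
  simpleNegativeCycle {σ = σ} W W⁻ inj = cycle , trans (signProd-signAt W) W⁻
    where
    cycle : Cycle σ (length W)
    cycle = record
      { len≥2 = negativeClosedWalk-length≥2 W W⁻
      ; vs = source W
      ; ss = signAt W
      ; distinct = inj
      ; adjacent = λ i → subst (Edge σ _ _) (target≡source∘next W i) (edgeAt W i)
      ; edgesDistinct = closedWalk-edgesDistinct W W⁻ inj
      }

  pathWalk : (f : Fin (suc m) → V) (s : Fin m → Sign) →
             (∀ i → Edge σ (s i) (f (inject₁ i)) (f (suc i))) →
             HasWalk σ (f zero) (f (fromℕ m)) m (signProd s)
  pathWalk {m = zero} f s e = [] , refl , refl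
  pathWalk {m = suc m} f s e =
    let (W , W-length , W-sign) = pathWalk (f ∘ suc) (s ∘ suc) (e ∘ suc)
    in step (s zero) (e zero) W , cong suc W-length , cong (s zero ·_) W-sign

  adjacent-inject₁ : (c : Cycle σ (suc m)) (i : Fin m) →
                     Edge σ (ss c (inject₁ i)) (vs c (inject₁ i)) (vs c (suc i))
  adjacent-inject₁ {σ = σ} c i =
    subst (Edge σ (ss c (inject₁ i)) (vs c (inject₁ i)) ∘ vs c) (next-inject₁ i) (adjacent c (inject₁ i))

  adjacent-fromℕ : (c : Cycle σ (suc m)) → Edge σ (ss c (fromℕ m)) (vs c (fromℕ m)) (vs c zero)
  adjacent-fromℕ {σ = σ} {m} c =
    subst (Edge σ (ss c (fromℕ m)) (vs c (fromℕ m)) ∘ vs c) (next-fromℕ m) (adjacent c (fromℕ m))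

  -- Starting at the last vertex of the cycle makes the length of the walk suc m by definition.
  cycle⇒closedWalk : (c : Cycle σ k) → ∃ λ x → HasWalk σ x x k (cycleSign c)
  cycle⇒closedWalk {k = zero} c = case len≥2 c of λ ()
  cycle⇒closedWalk {k = suc m} c with pathWalk (vs c) (ss c ∘ inject₁) (adjacent-inject₁ c)
  ... | W , W-length , W-sign =
    vs c (fromℕ m) , step (ss c (fromℕ m)) (adjacent-fromℕ c) W , cong suc W-length , closed-sign
    where
    open ≡-Reasoning
    closed-sign : ss c (fromℕ m) · sign W ≡ cycleSign c
    closed-sign = begin
      ss c (fromℕ m) · sign W                    ≡⟨ cong (ss c (fromℕ m) ·_) W-sign ⟩
      ss c (fromℕ m) · signProd (ss c ∘ inject₁) ≡⟨ ·-comm (ss c (fromℕ m)) _ ⟩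
      signProd (ss c ∘ inject₁) · ss c (fromℕ m) ≡⟨ signProd-last (ss c) ⟨
      cycleSign c                                ∎

  negativeCycle⇒negativeClosedWalk : NegativeCycle σ k → NegativeClosedWalk σ k
  negativeCycle⇒negativeClosedWalk (c , c⁻) =
    let (x , W , W-length , W-sign) = cycle⇒closedWalk c in x , W , W-length , trans W-sign c⁻

  length-loop : (P : Walk σ x u) (C : Walk σ u u) (Q : Walk σ u x) →
                length (P ++ C ++ Q) ≡ length C + (length P + length Q)
  length-loop P C Q = begin
    length (P ++ C ++ Q)                 ≡⟨ length-++ P (C ++ Q) ⟩
    length P + length (C ++ Q)           ≡⟨ cong (length P +_) (length-++ C Q) ⟩
    length P + (length C + length Q)     ≡⟨ m+[n+o]≡n+[m+o] (length P) (length C) (length Q) ⟩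
    length C + (length P + length Q)     ∎
    where open ≡-Reasoning

  loop-shorter : (P : Walk σ x u) (C : Walk σ u u) (Q : Walk σ u x) →
                 0 < length C → 0 < length P + length Q →
                 length C < length (P ++ C ++ Q) × length (Q ++ P) < length (P ++ C ++ Q)
  loop-shorter P C Q 0<C 0<P+Q
    rewrite length-loop P C Q | length-++ Q P | ℕ.+-comm (length Q) (length P) =
    ℕ.m<m+n (length C) 0<P+Q , ℕ.m<n+m (length P + length Q) 0<C

  sign-loop : (P : Walk σ x u) (C : Walk σ u u) (Q : Walk σ u x) →
              sign (P ++ C ++ Q) ≡ sign C · sign (Q ++ P)
  sign-loop P C Q = begin
    sign (P ++ C ++ Q)                   ≡⟨ sign-++ P (C ++ Q) ⟩
    sign P · sign (C ++ Q)               ≡⟨ cong (sign P ·_) (sign-++ C Q) ⟩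
    sign P · (sign C · sign Q)           ≡⟨ a·[b·c]≡b·[a·c] (sign P) (sign C) (sign Q) ⟩
    sign C · (sign P · sign Q)           ≡⟨ cong (sign C ·_) (·-comm (sign P) (sign Q)) ⟩
    sign C · (sign Q · sign P)           ≡⟨ cong (sign C ·_) (sign-++ Q P) ⟨
    sign C · sign (Q ++ P)               ∎
    where open ≡-Reasoning

  data Decomposition {σ : SignedGraph V} {x z : V} (W : Walk σ x z) : Set where
    simple   : Injective _≡_ _≡_ (source W) → Decomposition W
    withLoop : (P : Walk σ x u) (C : Walk σ u u) (Q : Walk σ u z) →
               0 < length C → 0 < length P + length Q → W ≡ P ++ C ++ Q → Decomposition W

  module _ (_≟_ : DecidableEquality V) where

    firstVisit : (u : V) (W : Walk σ y z) →
                 (Σ (Walk σ y u) λ P → Σ (Walk σ u z) λ Q → 0 < length Q × W ≡ P ++ Q)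
                 ⊎ (∀ i → source W i ≢ u)
    firstVisit u [] = inj₂ λ ()
    firstVisit u (step {x = y} s e W) with y ≟ u
    ... | yes refl = inj₁ ([] , step s e W , s≤s z≤n , refl)
    ... | no y≢u with firstVisit u W
    ...   | inj₁ (P , Q , 0<Q , refl) = inj₁ (step s e P , Q , 0<Q , refl)
    ...   | inj₂ unvisited = inj₂ λ { zero → y≢u ; (suc i) → unvisited i }

    decompose : (W : Walk σ x z) → Decomposition W
    decompose [] = simple λ { {()} }
    decompose (step s e W) with decompose W
    ... | withLoop P C Q 0<C _ refl = withLoop (step s e P) C Q 0<C (s≤s z≤n) refl
    decompose (step {x = x} s e W) | simple inj with firstVisit x W
    ...   | inj₁ (P , Q , 0<Q , refl) = withLoop [] (step s e P) Q (s≤s z≤n) 0<Q refl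
    ...   | inj₂ unvisited = simple injective
      where
      injective : Injective _≡_ _≡_ (source (step s e W))
      injective {zero} {zero} _ = refl
      injective {zero} {suc j} x≡ = ⊥-elim (unvisited j (sym x≡))
      injective {suc i} {zero} ≡x = ⊥-elim (unvisited i ≡x)
      injective {suc i} {suc j} eq = cong suc (inj eq)

    -- A closed walk with a repeated vertex is the sum of two shorter closed walks, one of
    -- which is negative if the walk is.
    negativeClosedWalk⇒negativeCycle :
      NegativeClosedWalk σ k → ∃ λ j → j ≤ k × NegativeCycle σ j
    negativeClosedWalk⇒negativeCycle (_ , W , refl , W⁻) = shorten W (<-wellFounded (length W)) W⁻
      where
      shorten : (W : Walk σ x x) → Acc _<_ (length W) → sign W ≡ neg →
                ∃ λ j → j ≤ length W × NegativeCycle σ j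
      shorten W (acc shorter) W⁻ with decompose W
      ... | simple inj = length W , ℕ.≤-refl , simpleNegativeCycle W W⁻ inj
      ... | withLoop P C Q 0<C 0<P+Q refl with loop-shorter P C Q 0<C 0<P+Q
      ...   | C<W , R<W with ·≡neg⇒neg⊎neg (trans (sym (sign-loop P C Q)) W⁻)
      ...     | inj₁ C⁻ =
        let (j , j≤C , c) = shorten C (shorter C<W) C⁻ in j , ℕ.≤-trans j≤C (ℕ.<⇒≤ C<W) , c
      ...     | inj₂ R⁻ =
        let (j , j≤R , c) = shorten (Q ++ P) (shorter R<W) R⁻ in j , ℕ.≤-trans j≤R (ℕ.<⇒≤ R<W) , c

  least-negativeCycle : DecidableEquality V →
                        ∀ {m} → Least (NegativeClosedWalk σ) m → Least (NegativeCycle σ) m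
  least-negativeCycle _≟_ =
    least-cong (λ _ → negativeClosedWalk⇒negativeCycle _≟_)
               (λ k c → k , ℕ.≤-refl , negativeCycle⇒negativeClosedWalk c)

  Least⇒IsNegativeGirth : ∀ m → Least (NegativeCycle σ) m → IsNegativeGirth σ m
  Least⇒IsNegativeGirth nothing none k c c⁻ = none k (c , c⁻)
  Least⇒IsNegativeGirth (just g) (c , least) = c , λ k c c⁻ → least k (c , c⁻)

  Least⇒IsOddGirth : ∀ m → Least (OddCycle σ) m → IsOddGirth σ m
  Least⇒IsOddGirth nothing none k c odd = none k (c , odd)
  Least⇒IsOddGirth (just g) (c , least) = c , λ k c odd → least k (c , odd)

  -- Switching at X makes τ all-negative, so every edge xy of τ has sign neg · switchSign (X x) (X y).
  sign≡parity·switchSign : (X : V → Bool) → AllNegative (switch X τ) →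
                           (W : Walk τ x y) → sign W ≡ parity (length W) · switchSign (X x) (X y)
  sign≡parity·switchSign {x = x} X allNeg [] = sym (switchSign-refl (X x))
  sign≡parity·switchSign X allNeg (step {x = x} {y = y} {z = z} s e W) = begin
    s · sign W                                        ≡⟨ cong₂ _·_ s≡ (sign≡parity·switchSign X allNeg W) ⟩
    (neg · xy) · (parity (length W) · yz)             ≡⟨ ·-interchange neg xy (parity (length W)) yz ⟩
    parity (suc (length W)) · (xy · yz)               ≡⟨ cong (parity (suc (length W)) ·_) (switchSign-trans (X x) (X y) (X z)) ⟩
    parity (suc (length W)) · switchSign (X x) (X z)  ∎
    where
    open ≡-Reasoning
    xy yz : Sign
    xy = switchSign (X x) (X y)
    yz = switchSign (X y) (X z)
    s≡ : s ≡ neg · xy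
    s≡ = ≢⇒≡neg· {s} {xy} λ { refl → case trans (sym e) (allNeg x y) of λ () }

  cycleSign≡parity : SwitchingEquivalentToAllNegative τ → (c : Cycle τ k) → cycleSign c ≡ parity k
  cycleSign≡parity (X , allNeg) c with cycle⇒closedWalk c
  ... | x , W , refl , W-sign = begin
      cycleSign c                                     ≡⟨ sym W-sign ⟩
      sign W                                          ≡⟨ sign≡parity·switchSign X allNeg W ⟩
      parity (length W) · switchSign (X x) (X x)      ≡⟨ cong (parity (length W) ·_) (switchSign-refl (X x)) ⟩
      parity (length W) · pos                         ≡⟨ ·-identityʳ (parity (length W)) ⟩
      parity (length W)                               ∎
    where open ≡-Reasoning

  least-oddCycle : SwitchingEquivalentToAllNegative τ →
                   ∀ {m} → Least (NegativeCycle τ) m → Least (OddCycle τ) m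
  least-oddCycle {τ = τ} switchable = least-cong negative⇒odd odd⇒negative
    where
    negative⇒odd : ∀ k → NegativeCycle τ k → ∃ λ j → j ≤ k × OddCycle τ j
    negative⇒odd k (c , c⁻) =
      k , ℕ.≤-refl , c , parity≡neg⇒odd k (trans (sym (cycleSign≡parity switchable c)) c⁻)
    odd⇒negative : ∀ k → OddCycle τ k → ∃ λ j → j ≤ k × NegativeCycle τ j
    odd⇒negative k (c , odd) =
      k , ℕ.≤-refl , c , trans (cycleSign≡parity switchable c) (odd⇒parity≡neg k odd)

hasWalk? : (σ : SignedGraph (Fin n)) → ∀ k x y s → Dec (HasWalk σ x y k s)
hasWalk? σ zero x y s with x Fin.≟ y | s
... | yes refl | pos = yes ([] , refl , refl)
... | yes refl | neg = no λ { ([] , _ , ()) ; (step _ _ _ , () , _) }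
... | no x≢y | _ = no λ { ([] , _ , _) → x≢y refl ; (step _ _ _ , () , _) }
hasWalk? {n} σ (suc k) x y s = map′ extend restrict (any? firstStep?)
  where
  FirstStep : Fin n → Set
  FirstStep z = (Edge σ pos x z × HasWalk σ z y k s) ⊎ (Edge σ neg x z × HasWalk σ z y k (neg · s))
  firstStep? : ∀ z → Dec (FirstStep z)
  firstStep? z = (edge σ pos x z Bool.≟ true ×-dec hasWalk? σ k z y s)
          ⊎-dec (edge σ neg x z Bool.≟ true ×-dec hasWalk? σ k z y (neg · s))
  extend : ∃ FirstStep → HasWalk σ x y (suc k) s
  extend (_ , inj₁ (e , W , W-length , W-sign)) = step pos e W , cong suc W-length , W-sign
  extend (_ , inj₂ (e , W , W-length , W-sign)) =
    step neg e W , cong suc W-length , trans (cong (neg ·_) W-sign) (neg-involutive s)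
  restrict : HasWalk σ x y (suc k) s → ∃ FirstStep
  restrict (step pos e W , W-length , W-sign) = _ , inj₁ (e , W , ℕ.suc-injective W-length , W-sign)
  restrict (step neg e W , W-length , W-sign) =
    _ , inj₂ (e , W , ℕ.suc-injective W-length ,
              trans (sym (neg-involutive (sign W))) (cong (neg ·_) W-sign))

least-negativeClosedWalk : (σ : SignedGraph (Fin n)) → ∃ (Least (NegativeClosedWalk σ))
least-negativeClosedWalk {n} σ = least? (λ k → any? λ x → hasWalk? σ k x x neg) n bounded
  where
  bounded : ∀ k → NegativeClosedWalk σ k → ∃ λ j → j ≤ n × NegativeClosedWalk σ j
  bounded k W = let (j , _ , c) = negativeClosedWalk⇒negativeCycle Fin._≟_ W in
    j , injective⇒≤ (distinct (proj₁ c)) , negativeCycle⇒negativeClosedWalk c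

-- The layer of the extended double cover reached from layer a along a lifted edge of sign s.
layerAfter : Sign → Bool → Bool
layerAfter pos a = a
layerAfter neg a = not a

switchSign-layerAfter : ∀ s a → switchSign a (layerAfter s a) ≡ s
switchSign-layerAfter pos false = refl
switchSign-layerAfter pos true = refl
switchSign-layerAfter neg false = refl
switchSign-layerAfter neg true = refl

module _ {σ : SignedGraph (Fin n)} where

  private
    variable
      x y : Fin n

  EDC-edge-pos : ∀ a b → edge (EDC σ) pos (x , a) (y , b) ≡ edge σ (switchSign a b) x y
  EDC-edge-pos false false = refl
  EDC-edge-pos false true = refl
  EDC-edge-pos true false = refl
  EDC-edge-pos true true = refl

  EDC-edge-neg : Edge (EDC σ) neg (x , a) (y , b) → x ≡ y × switchSign a b ≡ neg
  EDC-edge-neg {x} {a} {y} {b} e with x Fin.≟ y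
  EDC-edge-neg {a = false} {b = true} e | yes refl = refl , refl
  EDC-edge-neg {a = true} {b = false} e | yes refl = refl , refl
  EDC-edge-neg {a = false} {b = false} () | yes refl
  EDC-edge-neg {a = true} {b = true} () | yes refl
  EDC-edge-neg () | no _

  EDC-vertical : ∀ x a b → switchSign a b ≡ neg → Edge (EDC σ) neg (x , b) (x , a)
  EDC-vertical x a b _ with x Fin.≟ x
  EDC-vertical x false true _ | yes _ = refl
  EDC-vertical x true false _ | yes _ = refl
  EDC-vertical x _ _ _ | no x≢x = ⊥-elim (x≢x refl)

  -- P is W with its vertical edges, which are exactly its negative edges, deleted.
  project : (W : Walk (EDC σ) (x , a) (y , b)) →
            Σ (Walk σ x y) λ P → length P + negatives W ≡ length W × sign P · sign W ≡ switchSign a b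
  project {a = a} [] = [] , refl , sym (switchSign-refl a)
  project {a = a} {b = b} (step {y = x′ , a′} pos e W) =
    let (P , P-length , P-sign) = project W in
    step (switchSign a a′) (trans (sym (EDC-edge-pos a a′)) e) P , cong suc P-length ,
    trans (·-assoc (switchSign a a′) (sign P) (sign W))
          (trans (cong (switchSign a a′ ·_) P-sign) (switchSign-trans a a′ b))
  project {x = x} {a = a} {b = b} (step {y = x′ , a′} neg e W)
    with EDC-edge-neg {x} {a} {x′} {a′} e
  ... | refl , a⇄a′ =
    let (P , P-length , P-sign) = project W in
    P , trans (ℕ.+-suc (length P) (negatives W)) (cong suc P-length) ,
    trans (a·[b·c]≡b·[a·c] (sign P) neg (sign W))
          (trans (cong₂ _·_ (sym a⇄a′) P-sign) (switchSign-trans a a′ b))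

  lift : (W : Walk σ x y) (a : Bool) →
         ∃ λ b → switchSign a b ≡ sign W × HasWalk (EDC σ) (x , a) (y , b) (length W) pos
  lift [] a = a , switchSign-refl a , [] , refl , refl
  lift (step {x = x} {y = y} s e W) a =
    let (b , a′⇄b , W′ , W′-length , W′-sign) = lift W (layerAfter s a) in
    b , trans (sym (switchSign-trans a (layerAfter s a) b)) (cong₂ _·_ (switchSign-layerAfter s a) a′⇄b) ,
    step pos lifted W′ , cong suc W′-length , W′-sign
    where
    lifted : Edge (EDC σ) pos (x , a) (y , layerAfter s a)
    lifted = trans (EDC-edge-pos a (layerAfter s a))
                   (subst (λ t → edge σ t x y ≡ true) (sym (switchSign-layerAfter s a)) e)

  EDC-negativeClosedWalk : NegativeClosedWalk σ k → NegativeClosedWalk (EDC σ) (suc k)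
  EDC-negativeClosedWalk (x , W , refl , W⁻) =
    let (b , false⇄b , W′ , W′-length , W′-sign) = lift W false in
    (x , b) , step neg (EDC-vertical x false b (trans false⇄b W⁻)) W′ ,
    cong suc W′-length , cong (neg ·_) W′-sign

  EDC-negativeClosedWalk⁻¹ : NegativeClosedWalk (EDC σ) k → ∃ λ j → j < k × NegativeClosedWalk σ j
  EDC-negativeClosedWalk⁻¹ ((x , a) , W , refl , W⁻) with project W
  ... | P , P-length , P-sign =
    length P , P<W , x , P , refl , trans (·≡pos⇒≡ (trans P-sign (switchSign-refl a))) W⁻
    where
    0<negatives : 0 < negatives W
    0<negatives = ℕ.n≢0⇒n>0 λ none →
      case trans (sym W⁻) (trans (sign≡parity-negatives W) (cong parity none)) of λ ()
    P<W : length P < length W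
    P<W = subst (length P <_) P-length (ℕ.m<m+n (length P) 0<negatives)

  least-EDC : ∀ {m} → Least (NegativeClosedWalk σ) m → Least (NegativeClosedWalk (EDC σ)) (m +1)
  least-EDC = least-suc (λ _ → EDC-negativeClosedWalk) (λ _ → EDC-negativeClosedWalk⁻¹)

  EDC-bipartite : SwitchingEquivalentToAllNegative σ → IsBipartite (EDC σ)
  EDC-bipartite (X , allNeg) = colour , proper
    where
    colour : Fin n × Bool → Bool
    colour (x , a) = X x xor a
    proper : ∀ s u v → Edge (EDC σ) s u v → colour u ≢ colour v
    proper pos (x , a) (y , b) e same = case trans (sym e) no-edge of λ ()
      where
      no-edge : edge (EDC σ) pos (x , a) (y , b) ≡ false
      no-edge = trans (EDC-edge-pos a b)
        (subst (λ t → edge σ t x y ≡ false) (xor≡⇒switchSign≡ (X x) (X y) a b same) (allNeg x y))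
    proper neg (x , a) (y , b) e same with EDC-edge-neg {x} {a} {y} {b} e
    ... | refl , a⇄b =
      case trans (sym (switchSign-refl (X x))) (trans (xor≡⇒switchSign≡ (X x) (X x) a b same) a⇄b) of λ ()

  EDC-switchingEquivalentToAllNegative : IsBipartite σ → SwitchingEquivalentToAllNegative (EDC σ)
  EDC-switchingEquivalentToAllNegative (colour , proper) = colour ∘ proj₁ , allNeg
    where
    allNeg : AllNegative (switch (colour ∘ proj₁) (EDC σ))
    allNeg (x , a) (y , b) with colour x Bool.≟ colour y
    ... | yes same =
      subst (λ t → edge (EDC σ) t (x , a) (y , b) ≡ false)
            (sym (trans (cong (λ c → switchSign c (colour y)) same) (switchSign-refl (colour y))))
            (trans (EDC-edge-pos a b) (¬-not λ e → proper _ x y e same))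
    ... | no differ =
      subst (λ t → edge (EDC σ) t (x , a) (y , b) ≡ false)
            (sym (switchSign-≢ differ))
            (¬-not λ e → differ (cong colour (proj₁ (EDC-edge-neg {x} {a} {y} {b} e))))

mainTheorem3 : ∀ (n : ℕ) (σ : SignedGraph (Fin n)) →
    (SwitchingEquivalentToAllNegative σ →
      IsBipartite (EDC σ)
      × Σ (Maybe ℕ) (λ m → IsNegativeGirth σ m × IsNegativeGirth (EDC σ) (m +1)))
    × (IsBipartite σ →
      SwitchingEquivalentToAllNegative (EDC σ)
      × Σ (Maybe ℕ) (λ m → IsNegativeGirth σ m
          × IsNegativeGirth (EDC σ) (m +1)
          × IsOddGirth (EDC σ) (m +1)))
mainTheorem3 n σ =
  (λ switchable → EDC-bipartite switchable , g , girth , girth-EDC) ,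
  (λ bipartite →
    let switchable = EDC-switchingEquivalentToAllNegative bipartite in
    switchable , g , girth , girth-EDC ,
    Least⇒IsOddGirth (g +1) (least-oddCycle switchable least-cycle-EDC))
  where
  least-walk : ∃ (Least (NegativeClosedWalk σ))
  least-walk = least-negativeClosedWalk σ
  g : Maybe ℕ
  g = proj₁ least-walk
  least-cycle-EDC : Least (NegativeCycle (EDC σ)) (g +1)
  least-cycle-EDC = least-negativeCycle (≡-dec Fin._≟_ Bool._≟_) (least-EDC (proj₂ least-walk))
  girth : IsNegativeGirth σ g
  girth = Least⇒IsNegativeGirth g (least-negativeCycle Fin._≟_ (proj₂ least-walk))
  girth-EDC : IsNegativeGirth (EDC σ) (g +1)
  girth-EDC = Least⇒IsNegativeGirth (g +1) least-cycle-EDC
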